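{- For every integer base $b\geq2$, the infinite periodic word $\mathbf{1}=111\cdots$ is not finite factorial with respect to $b$.
   Context: For an infinite word $a_1a_2\cdots$ over $\{0,\dots,b-1\}$ let $u_k=\sum_{i=1}^ka_ib^{k-i}$; $F_r$ is the set of prime divisors of a positive integer $r$. A word is finite factorial with respect to $b$ if there is a strictly increasing sequence $(n_i)_{i\ge1}$ of positive integers such that $\bigcup_{i\ge1}F_{u_{n_i}}$ is finite. -}

module Defs where

open import Data.Nat using (ℕ; zero; suc; _+_; _*_; _<_; _≤_)
open import Data.Nat.Divisibility using (_∣_)
open import Data.Nat.Primality using (Prime)
open import Data.Fin using (Fin; toℕ; fromℕ<)
open import Data.List using (List)
open import Data.List.Membership.Propositional using (_∈_)
open import Data.Product using (Σ; _×_; ∃)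

-- An infinite word a₁a₂⋯ over {0,…,b-1}: the letter aᵢ is  w i  for i ≥ 1
-- (the value  w 0  is irrelevant and never used).
Word : ℕ → Set
Word b = ℕ → Fin b

-- u k = Σ_{i=1}^{k} aᵢ b^{k-i}, computed by Horner's rule:
-- u 0 = 0,  u (k+1) = b · u k + a_{k+1}.
u : ∀ {b} → Word b → ℕ → ℕ
u {b} w zero    = 0
u {b} w (suc k) = b * u w k + toℕ (w (suc k))

StrictlyIncreasing : (ℕ → ℕ) → Set
StrictlyIncreasing n = ∀ i → n i < n (suc i)

-- The word is finite factorial w.r.t. b: there is a strictly increasing
-- sequence (nᵢ) of positive integers such that ⋃ᵢ F_{u_{nᵢ}} is finite,
-- i.e. contained in some finite list S of numbers.
FiniteFactorial : ∀ b → Word b → Set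
FiniteFactorial b w =
  Σ (ℕ → ℕ) λ n →
    StrictlyIncreasing n ×
    (∀ i → 1 ≤ n i) ×
    Σ (List ℕ) λ S → ∀ i p → Prime p → p ∣ u w (n i) → p ∈ S

ones : ∀ b → 2 ≤ b → Word b
ones b h _ = fromℕ< {1} {b} h

{-# OPTIONS --safe #-}
module Submission where

-- For the word 111⋯, u n is the repunit Rᵦ(n) = 1 + b + ⋯ + bⁿ⁻¹. Suppose all Rᵦ(n) for n in an
-- infinite set have their prime factors in a finite set S. Primes dividing b never divide
-- Rᵦ(n); let Q be the product of the other primes of S, and pick t with b^(t+1) = 1 + d and
-- Q² ∣ d (pigeonhole on the powers of b modulo Q²). Then Rᵦ(n) divides
-- Rᵦ(n(t+1)) = Rᵦ(t+1) · R₁₊d(n), and since Q² ∣ d, lifting the exponent shows that the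
-- Q-smooth part of R₁₊d(n) divides n. So Rᵦ(n) ∣ Rᵦ(t+1) · n, which fails for large n since
-- Rᵦ grows exponentially.

open import Data.Fin using (toℕ; fromℕ<)
open import Data.Fin.Properties using (pigeonhole; toℕ-fromℕ<)
open import Data.List using (List; []; _∷_; _++_; filter)
open import Data.List.Membership.Propositional using (_∈_)
open import Data.List.Membership.Propositional.Properties using (∈-filter⁺)
open import Data.List.Relation.Unary.All as All using (All; []; _∷_)
open import Data.List.Relation.Unary.All.Properties using (++⁺; all-filter)
open import Data.Nat
open import Data.Nat.Divisibility
open import Data.Nat.DivMod using (_%_; _/_; m≡m%n+[m/n]*n; m%n<n)
open import Data.Nat.ListAction using (product)
open import Data.Nat.ListAction.Properties using (∈⇒∣product; product-++)
open import Data.Nat.Primality using (Prime; prime?; euclidsLemma; ¬prime[1]; prime⇒nonZero; productOfPrimes≢0)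
open import Data.Nat.Primality.Factorisation using (PrimeFactorisation; factorise; factors)
open import Data.Nat.Properties
open import Data.Nat.Solver using (module +-*-Solver)
open import Data.Product using (∃; ∃₂; _×_; _,_; proj₁; proj₂; map₂)
open import Data.Sum using (inj₁; inj₂)
open import Function using (_∘_)
open import Relation.Binary.PropositionalEquality
open import Relation.Nullary using (¬_; contradiction; yes; no)
open import Relation.Nullary.Decidable using (_×-dec_; ¬?)
open import Relation.Unary using (Decidable)

open import Defs

open +-*-Solver

repunit : ℕ → ℕ → ℕ
repunit c zero    = 0
repunit c (suc n) = c ^ n + repunit c n

repunit-suc : ∀ c n → repunit c (suc n) ≡ 1 + c * repunit c n
repunit-suc c zero    = cong suc (sym (*-zeroʳ c))
repunit-suc c (suc n) = begin
  c * c ^ n + repunit c (suc n)     ≡⟨ cong (c * c ^ n +_) (repunit-suc c n) ⟩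
  c * c ^ n + (1 + c * repunit c n) ≡⟨ rearrange c (c ^ n) (repunit c n) ⟩
  1 + c * (c ^ n + repunit c n)     ∎
  where
  open ≡-Reasoning
  rearrange : ∀ c x r → c * x + (1 + c * r) ≡ 1 + c * (x + r)
  rearrange = solve 3 (λ c x r → c :* x :+ (con 1 :+ c :* r) := con 1 :+ c :* (x :+ r)) refl

repunit-+ : ∀ c m n → repunit c (n + m) ≡ repunit c m + c ^ m * repunit c n
repunit-+ c m zero    = sym (trans (cong (repunit c m +_) (*-zeroʳ (c ^ m))) (+-identityʳ _))
repunit-+ c m (suc n) = begin
  c ^ (n + m) + repunit c (n + m)
    ≡⟨ cong₂ _+_ (^-distribˡ-+-* c n m) (repunit-+ c m n) ⟩
  c ^ n * c ^ m + (repunit c m + c ^ m * repunit c n)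
    ≡⟨ rearrange (c ^ n) (c ^ m) (repunit c m) (repunit c n) ⟩
  repunit c m + c ^ m * (c ^ n + repunit c n)
    ∎
  where
  open ≡-Reasoning
  rearrange : ∀ x y s t → x * y + (s + y * t) ≡ s + y * (x + t)
  rearrange = solve 4 (λ x y s t → x :* y :+ (s :+ y :* t) := s :+ y :* (x :+ t)) refl

repunit-* : ∀ c m n → repunit c (m * n) ≡ repunit c m * repunit (c ^ m) n
repunit-* c m zero    = trans (cong (repunit c) (*-zeroʳ m)) (sym (*-zeroʳ (repunit c m)))
repunit-* c m (suc n) = begin
  repunit c (m * suc n)
    ≡⟨ cong (repunit c) (trans (*-suc m n) (+-comm m (m * n))) ⟩
  repunit c (m * n + m)
    ≡⟨ repunit-+ c m (m * n) ⟩
  repunit c m + c ^ m * repunit c (m * n)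
    ≡⟨ cong (λ r → repunit c m + c ^ m * r) (repunit-* c m n) ⟩
  repunit c m + c ^ m * (repunit c m * repunit (c ^ m) n)
    ≡⟨ rearrange (repunit c m) (c ^ m) (repunit (c ^ m) n) ⟩
  repunit c m * (1 + c ^ m * repunit (c ^ m) n)
    ≡⟨ cong (repunit c m *_) (repunit-suc (c ^ m) n) ⟨
  repunit c m * repunit (c ^ m) (suc n)
    ∎
  where
  open ≡-Reasoning
  rearrange : ∀ s x t → s + x * (s * t) ≡ s * (1 + x * t)
  rearrange = solve 3 (λ s x t → s :+ x :* (s :* t) := s :* (con 1 :+ x :* t)) refl

^-repunit : ∀ d n → suc d ^ n ≡ 1 + d * repunit (suc d) n
^-repunit d zero    = cong suc (sym (*-zeroʳ d))
^-repunit d (suc n) = begin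
  suc d * suc d ^ n
    ≡⟨ cong (suc d *_) (^-repunit d n) ⟩
  suc d * (1 + d * repunit (suc d) n)
    ≡⟨ rearrange d (repunit (suc d) n) ⟩
  1 + d * ((1 + d * repunit (suc d) n) + repunit (suc d) n)
    ≡⟨ cong (λ x → 1 + d * (x + repunit (suc d) n)) (^-repunit d n) ⟨
  1 + d * repunit (suc d) (suc n)
    ∎
  where
  open ≡-Reasoning
  rearrange : ∀ d r → suc d * (1 + d * r) ≡ 1 + d * ((1 + d * r) + r)
  rearrange = solve 2 (λ d r → (con 1 :+ d) :* (con 1 :+ d :* r) := con 1 :+ d :* ((con 1 :+ d :* r) :+ r)) refl

repunit-≡-length : ∀ d n → ∃ λ r → repunit (suc d) n ≡ n + d * r
repunit-≡-length d zero = 0 , sym (*-zeroʳ d)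
repunit-≡-length d (suc n) with r , eq ← repunit-≡-length d n =
  r + n + d * r , (begin
    repunit (suc d) (suc n)         ≡⟨ repunit-suc (suc d) n ⟩
    1 + suc d * repunit (suc d) n   ≡⟨ cong (λ x → 1 + suc d * x) eq ⟩
    1 + suc d * (n + d * r)         ≡⟨ rearrange d n r ⟩
    suc n + d * (r + n + d * r)     ∎)
  where
  open ≡-Reasoning
  rearrange : ∀ d n r → 1 + suc d * (n + d * r) ≡ suc n + d * (r + n + d * r)
  rearrange = solve 3 (λ d n r → con 1 :+ (con 1 :+ d) :* (n :+ d :* r) := (con 1 :+ n) :+ d :* (r :+ n :+ d :* r)) refl

prime∤1+* : ∀ {p c} → Prime p → p ∣ c → ∀ z → ¬ p ∣ 1 + c * z
prime∤1+* {p} {c} pp p∣c z p∣1+cz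
  with refl ← ∣1⇒≡1 (∣m+n∣m⇒∣n (subst (p ∣_) (+-comm 1 (c * z)) p∣1+cz) (∣-trans p∣c (m∣m*n z)))
  = ¬prime[1] pp

prime∣^⇒∣ : ∀ {p} c n → Prime p → p ∣ c ^ n → p ∣ c
prime∣^⇒∣ c zero    pp p∣1 with refl ← ∣1⇒≡1 p∣1 = contradiction pp ¬prime[1]
prime∣^⇒∣ c (suc n) pp p∣cⁿ⁺¹ with euclidsLemma c (c ^ n) pp p∣cⁿ⁺¹
... | inj₁ p∣c  = p∣c
... | inj₂ p∣cⁿ = prime∣^⇒∣ c n pp p∣cⁿ

product-∣-cancelˡ : ∀ {c z} ps → All Prime ps → All (λ p → ¬ p ∣ c) ps →
                    product ps ∣ c * z → product ps ∣ z
product-∣-cancelˡ          []       _          _          _ = 1∣ _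
product-∣-cancelˡ {c} {z} (p ∷ ps) (pp ∷ pps) (p∤c ∷ ps∤c) ∏∣cz
  with euclidsLemma c z pp (∣-trans (m∣m*n (product ps)) ∏∣cz)
... | inj₁ p∣c = contradiction p∣c p∤c
... | inj₂ (divides z′ refl) = subst (p * product ps ∣_) (*-comm p z′)
  (*-monoʳ-∣ p (product-∣-cancelˡ ps pps ps∤c (*-cancelˡ-∣ p {{prime⇒nonZero pp}}
    (subst (p * product ps ∣_) (rearrange c z′ p) ∏∣cz))))
  where
  rearrange : ∀ c z p → c * (z * p) ≡ p * (c * z)
  rearrange = solve 3 (λ c z p → c :* (z :* p) := p :* (c :* z)) refl

m%o≡[m+n]%o⇒o∣n : ∀ m n o .{{_ : NonZero o}} → m % o ≡ (m + n) % o → o ∣ n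
m%o≡[m+n]%o⇒o∣n m n o eq = ∣m+n∣m⇒∣n (divides ((m + n) / o) (+-cancelˡ-≡ (m % o) _ _ (begin
    m % o + (m / o * o + n)       ≡⟨ +-assoc (m % o) _ n ⟨
    m % o + m / o * o + n         ≡⟨ cong (_+ n) (m≡m%n+[m/n]*n m o) ⟨
    m + n                         ≡⟨ m≡m%n+[m/n]*n (m + n) o ⟩
    (m + n) % o + (m + n) / o * o ≡⟨ cong (_+ (m + n) / o * o) eq ⟨
    m % o + (m + n) / o * o       ∎))) (n∣m*n (m / o))
  where open ≡-Reasoning

∃-^≡1-mod-product : ∀ b′ ps → All Prime ps → All (λ p → ¬ p ∣ suc b′) ps →
                    ∃₂ λ t d → suc b′ ^ suc t ≡ suc d × product ps ∣ d
∃-^≡1-mod-product b′ ps pps ps∤b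
  with i , j , i<j , fi≡fj ← pigeonhole (n<1+n (product ps))
         (λ k → fromℕ< (m%n<n (suc b′ ^ toℕ k) (product ps) {{productOfPrimes≢0 pps}}))
  with t , i+t≡j ← m≤n⇒∃[o]m+o≡n i<j
  = t , d , ^-repunit b′ (suc t) , product-∣-cancelˡ ps pps ps∤bⁱ N∣bⁱd
  where
  b N d bⁱ : ℕ
  b  = suc b′
  N  = product ps
  d  = b′ * repunit b (suc t)
  bⁱ = b ^ toℕ i
  instance
    N≢0 : NonZero N
    N≢0 = productOfPrimes≢0 pps
  bʲ≡bⁱ+bⁱd : b ^ toℕ j ≡ bⁱ + bⁱ * d
  bʲ≡bⁱ+bⁱd = begin
    b ^ toℕ j              ≡⟨ cong (b ^_) (trans (+-suc (toℕ i) t) i+t≡j) ⟨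
    b ^ (toℕ i + suc t)    ≡⟨ ^-distribˡ-+-* b (toℕ i) (suc t) ⟩
    bⁱ * b ^ suc t         ≡⟨ cong (bⁱ *_) (^-repunit b′ (suc t)) ⟩
    bⁱ * suc d             ≡⟨ *-suc bⁱ d ⟩
    bⁱ + bⁱ * d            ∎
    where open ≡-Reasoning
  bⁱ%N≡bʲ%N : bⁱ % N ≡ b ^ toℕ j % N
  bⁱ%N≡bʲ%N = trans (sym (toℕ-fromℕ< _)) (trans (cong toℕ fi≡fj) (toℕ-fromℕ< _))
  N∣bⁱd : N ∣ bⁱ * d
  N∣bⁱd = m%o≡[m+n]%o⇒o∣n bⁱ (bⁱ * d) N (trans bⁱ%N≡bʲ%N (cong (_% N) bʲ≡bⁱ+bⁱd))
  ps∤bⁱ : All (λ p → ¬ p ∣ bⁱ) ps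
  ps∤bⁱ = All.zipWith (λ (pp , p∤b) → p∤b ∘ prime∣^⇒∣ b (toℕ i) pp) (pps , ps∤b)

repunit≡p*[1+Q*z] : ∀ {Q p e} → Q * p ∣ e → ∃ λ z → repunit (suc e) p ≡ p * suc (Q * z)
repunit≡p*[1+Q*z] {Q} {p} {e} (divides k refl) with r , eq ← repunit-≡-length e p =
  k * r , trans eq (rearrange Q p k r)
  where
  rearrange : ∀ Q p k r → p + k * (Q * p) * r ≡ p * suc (Q * (k * r))
  rearrange = solve 4 (λ Q p k r → p :+ k :* (Q :* p) :* r := p :* (con 1 :+ Q :* (k :* r))) refl

repunit-peel : ∀ {p Q d} n → Prime p → p ∣ Q → Q * Q ∣ d → p ∣ repunit (suc d) n →
               ∃₂ λ m z → n ≡ m * p × repunit (suc d) n ≡ p * (suc (Q * z) * repunit (suc d) m)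
repunit-peel {p} {Q} {d} n pp p∣Q Q²∣d p∣Rn
  with r , Rn≡n+dr ← repunit-≡-length d n
  with divides m refl ← ∣m+n∣m⇒∣n (subst (p ∣_) (trans Rn≡n+dr (+-comm n (d * r))) p∣Rn)
                                  (∣-trans (∣-trans p∣Q (∣-trans (m∣m*n Q) Q²∣d)) (m∣m*n r))
  with z , eq ← repunit≡p*[1+Q*z] {Q} {p} {d * repunit (suc d) m}
                  (∣-trans (*-monoʳ-∣ Q p∣Q) (∣-trans Q²∣d (m∣m*n _)))
  = m , z , refl , (begin
    repunit (suc d) (m * p)     ≡⟨ repunit-* (suc d) m p ⟩
    R * repunit (suc d ^ m) p   ≡⟨ cong (λ c → R * repunit c p) (^-repunit d m) ⟩
    R * repunit (suc (d * R)) p ≡⟨ cong (R *_) eq ⟩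
    R * (p * suc (Q * z))       ≡⟨ rearrange R p (suc (Q * z)) ⟩
    p * (suc (Q * z) * R)       ∎)
  where
  open ≡-Reasoning
  R : ℕ
  R = repunit (suc d) m
  rearrange : ∀ x y w → x * (y * w) ≡ y * (w * x)
  rearrange = solve 3 (λ x y w → x :* (y :* w) := y :* (w :* x)) refl

-- Lifting the exponent: for a prime p ∣ Q, the power of p in R₁₊d(n) is exactly that in n.
product∣k*repunit⇒∣k*n : ∀ {Q d} → Q * Q ∣ d → ∀ ps → All Prime ps → All (_∣ Q) ps →
                         ∀ k n → product ps ∣ k * repunit (suc d) n → product ps ∣ k * n
product∣k*repunit⇒∣k*n _ []       _          _            k n _ = 1∣ (k * n)
product∣k*repunit⇒∣k*n {Q} {d} Q²∣d (p ∷ ps) (pp ∷ pps) (p∣Q ∷ ps∣Q) k n ∏∣kRn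
  with euclidsLemma k (repunit (suc d) n) pp (∣-trans (m∣m*n (product ps)) ∏∣kRn)
... | inj₁ (divides k′ refl) =
  subst (p * product ps ∣_) (rearrange p k′ n)
    (*-monoʳ-∣ p (product∣k*repunit⇒∣k*n Q²∣d ps pps ps∣Q k′ n
      (*-cancelˡ-∣ p (subst (p * product ps ∣_) (sym (rearrange p k′ (repunit (suc d) n))) ∏∣kRn))))
  where
  instance _ = prime⇒nonZero pp
  rearrange : ∀ p k n → p * (k * n) ≡ k * p * n
  rearrange = solve 3 (λ p k n → p :* (k :* n) := k :* p :* n) refl
... | inj₂ p∣Rn with m , z , refl , Rn≡ ← repunit-peel n pp p∣Q Q²∣d p∣Rn =
  subst (p * product ps ∣_) (rearrange p k m)
    (*-monoʳ-∣ p (product∣k*repunit⇒∣k*n Q²∣d ps pps ps∣Q k m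
      (product-∣-cancelˡ ps pps ps∤w
        (*-cancelˡ-∣ p (subst (p * product ps ∣_) (trans (cong (k *_) Rn≡) (rearrange′ k p w Rm)) ∏∣kRn)))))
  where
  instance _ = prime⇒nonZero pp
  w Rm : ℕ
  w  = suc (Q * z)
  Rm = repunit (suc d) m
  ps∤w : All (λ q → ¬ q ∣ w) ps
  ps∤w = All.zipWith (λ (pq , q∣Q) → prime∤1+* pq q∣Q z) (pps , ps∣Q)
  rearrange : ∀ p k m → p * (k * m) ≡ k * (m * p)
  rearrange = solve 3 (λ p k m → p :* (k :* m) := k :* (m :* p)) refl
  rearrange′ : ∀ k p w r → k * (p * (w * r)) ≡ p * (w * (k * r))
  rearrange′ = solve 4 (λ k p w r → k :* (p :* (w :* r)) := p :* (w :* (k :* r))) refl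

n<c^n : ∀ {c} → 2 ≤ c → ∀ n → n < c ^ n
n<c^n         2≤c zero    = s≤s z≤n
n<c^n {c} 2≤c (suc n) = begin-strict
  suc n             <⟨ +-monoʳ-< 1 (n<c^n 2≤c n) ⟩
  1 + c ^ n         ≤⟨ +-monoˡ-≤ (c ^ n) (≤-trans (s≤s z≤n) (n<c^n 2≤c n)) ⟩
  c ^ n + c ^ n     ≡⟨ cong (c ^ n +_) (+-identityʳ (c ^ n)) ⟨
  2 * c ^ n         ≤⟨ *-monoˡ-≤ (c ^ n) 2≤c ⟩
  c * c ^ n         ∎
  where open ≤-Reasoning

repunit-superlinear : ∀ {c} → 2 ≤ c → ∀ C m → suc C * m ≤ repunit c m + suc C * C
repunit-superlinear 2≤c C zero = subst (_≤ suc C * C) (sym (*-zeroʳ (suc C))) z≤n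
repunit-superlinear {c} 2≤c C (suc m) with C ≤? m
... | yes C≤m = begin
  suc C * suc m                            ≡⟨ *-suc (suc C) m ⟩
  suc C + suc C * m                        ≤⟨ +-mono-≤ (≤-trans (s≤s C≤m) (n<c^n 2≤c m))
                                                       (repunit-superlinear 2≤c C m) ⟩
  c ^ m + (repunit c m + suc C * C)        ≡⟨ +-assoc (c ^ m) _ _ ⟨
  repunit c (suc m) + suc C * C            ∎
  where open ≤-Reasoning
... | no C≰m = ≤-trans (*-monoʳ-≤ (suc C) (≰⇒> C≰m)) (m≤n+m (suc C * C) (repunit c (suc m)))

repunit≤C*n⇒n≤C+C*C : ∀ {c} → 2 ≤ c → ∀ C n → repunit c n ≤ C * n → n ≤ C + C * C
repunit≤C*n⇒n≤C+C*C {c} 2≤c C n Rn≤Cn = +-cancelʳ-≤ (C * n) n (C + C * C) (begin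
  n + C * n                 ≡⟨⟩
  suc C * n                 ≤⟨ repunit-superlinear 2≤c C n ⟩
  repunit c n + suc C * C   ≤⟨ +-monoˡ-≤ (suc C * C) Rn≤Cn ⟩
  C * n + (C + C * C)       ≡⟨ +-comm (C * n) _ ⟩
  C + C * C + C * n         ∎)
  where open ≤-Reasoning

∣k*repunit⇒∣k*n : ∀ {Q d} → Q * Q ∣ d → ∀ x .{{_ : NonZero x}} → (∀ {q} → Prime q → q ∣ x → q ∣ Q) →
                  ∀ k n → x ∣ k * repunit (suc d) n → x ∣ k * n
∣k*repunit⇒∣k*n {Q} Q²∣d x x-smooth k n x∣kRn =
  subst (_∣ k * n) (sym x≡∏)
    (product∣k*repunit⇒∣k*n Q²∣d (factors fx) primes (All.tabulate factor∣Q) k n (subst (_∣ _) x≡∏ x∣kRn))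
  where
  fx : PrimeFactorisation x
  fx = factorise x
  open PrimeFactorisation fx using () renaming (isFactorisation to x≡∏; factorsPrime to primes)
  factor∣Q : ∀ {q} → q ∈ factors fx → q ∣ Q
  factor∣Q q∈ = x-smooth (All.lookup primes q∈) (subst (_ ∣_) (sym x≡∏) (∈⇒∣product q∈))

repunit[1+n]≢0 : ∀ c n → NonZero (repunit c (suc n))
repunit[1+n]≢0 c n = subst NonZero (sym (repunit-suc c n)) _

repunit-smooth⇒n≤C+C*C : ∀ {b d Q} → 2 ≤ b → ∀ t → b ^ suc t ≡ suc d → Q * Q ∣ d →
  ∀ n → 1 ≤ n → (∀ {q} → Prime q → q ∣ repunit b n → q ∣ Q) →
  let C = repunit b (suc t) in n ≤ C + C * C
repunit-smooth⇒n≤C+C*C {b} {d} 2≤b t bᵗ⁺¹≡1+d Q²∣d n@(suc m) _ Rn-smooth =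
  repunit≤C*n⇒n≤C+C*C 2≤b C n (∣⇒≤ {{m*n≢0 C n}} Rn∣Cn)
  where
  instance
    _ = repunit[1+n]≢0 b m
    _ = repunit[1+n]≢0 b t
  C : ℕ
  C = repunit b (suc t)
  Rn∣CRn′ : repunit b n ∣ C * repunit (suc d) n
  Rn∣CRn′ = divides (repunit (b ^ n) (suc t)) (begin
    C * repunit (suc d) n                 ≡⟨ cong (λ c → C * repunit c n) bᵗ⁺¹≡1+d ⟨
    C * repunit (b ^ suc t) n             ≡⟨ repunit-* b (suc t) n ⟨
    repunit b (suc t * n)                 ≡⟨ cong (repunit b) (*-comm (suc t) n) ⟩
    repunit b (n * suc t)                 ≡⟨ repunit-* b n (suc t) ⟩
    repunit b n * repunit (b ^ n) (suc t) ≡⟨ *-comm (repunit b n) _ ⟩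
    repunit (b ^ n) (suc t) * repunit b n ∎)
    where open ≡-Reasoning
  Rn∣Cn : repunit b n ∣ C * n
  Rn∣Cn = ∣k*repunit⇒∣k*n Q²∣d (repunit b n) Rn-smooth C n Rn∣CRn′

repunit-∏-smooth⇒bounded : ∀ b′ → 2 ≤ suc b′ → ∀ ps → All Prime ps → All (λ p → ¬ p ∣ suc b′) ps →
  ∃ λ B → ∀ n → 1 ≤ n → (∀ {q} → Prime q → q ∣ repunit (suc b′) n → q ∣ product ps) → n ≤ B
repunit-∏-smooth⇒bounded b′ 2≤b ps pps ps∤b =
  let t , d , bᵗ⁺¹≡1+d , ∏ps²∣d = ∃-^≡1-mod-product b′ (ps ++ ps) (++⁺ pps pps) (++⁺ ps∤b ps∤b)
      C = repunit (suc b′) (suc t)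
  in C + C * C , repunit-smooth⇒n≤C+C*C 2≤b t bᵗ⁺¹≡1+d (subst (_∣ d) (product-++ ps ps) ∏ps²∣d)

prime∣repunit⇒∤base : ∀ {q c} n → 1 ≤ n → Prime q → q ∣ repunit c n → ¬ q ∣ c
prime∣repunit⇒∤base {q} {c} (suc n) _ pq q∣R q∣c =
  prime∤1+* pq q∣c (repunit c n) (subst (q ∣_) (repunit-suc c n) q∣R)

repunit-factors-in⇒bounded : ∀ b′ → 2 ≤ suc b′ → (S : List ℕ) →
  ∃ λ B → ∀ n → 1 ≤ n → (∀ {q} → Prime q → q ∣ repunit (suc b′) n → q ∈ S) → n ≤ B
repunit-factors-in⇒bounded b′ 2≤b S =
  map₂ (λ bound n n≥1 Rn-over-S → bound n n≥1 (λ pq q∣Rn →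
          ∈⇒∣product (∈-filter⁺ P? (Rn-over-S pq q∣Rn) (pq , prime∣repunit⇒∤base n n≥1 pq q∣Rn))))
       (repunit-∏-smooth⇒bounded b′ 2≤b F (All.map proj₁ F-good) (All.map proj₂ F-good))
  where
  P? : Decidable (λ p → Prime p × ¬ p ∣ suc b′)
  P? p = prime? p ×-dec ¬? (p ∣? suc b′)
  F : List ℕ
  F = filter P? S
  F-good : All (λ p → Prime p × ¬ p ∣ suc b′) F
  F-good = all-filter P? S

u-ones : ∀ b (2≤b : 2 ≤ b) n → u (ones b 2≤b) n ≡ repunit b n
u-ones b 2≤b zero    = refl
u-ones b 2≤b (suc n) = begin
  b * u (ones b 2≤b) n + toℕ (fromℕ< 2≤b) ≡⟨ cong₂ _+_ (cong (b *_) (u-ones b 2≤b n)) (toℕ-fromℕ< 2≤b) ⟩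
  b * repunit b n + 1                      ≡⟨ +-comm _ 1 ⟩
  1 + b * repunit b n                      ≡⟨ repunit-suc b n ⟨
  repunit b (suc n)                        ∎
  where open ≡-Reasoning

strictlyIncreasing⇒n<f : ∀ {f} → StrictlyIncreasing f → 1 ≤ f 0 → ∀ n → n < f n
strictlyIncreasing⇒n<f f-inc f0≥1 zero    = f0≥1
strictlyIncreasing⇒n<f f-inc f0≥1 (suc n) = <-≤-trans (s≤s (strictlyIncreasing⇒n<f f-inc f0≥1 n)) (f-inc n)

lemma5p4 : (b : ℕ) (hb : 2 ≤ b) → ¬ FiniteFactorial b (ones b hb)
lemma5p4 zero ()
lemma5p4 b@(suc b′) 2≤b (n , n-inc , n≥1 , S , S-covers) =
  let B , bound = repunit-factors-in⇒bounded b′ 2≤b S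
  in <⇒≱ (strictlyIncreasing⇒n<f n-inc (n≥1 0) B) (bound (n B) (n≥1 B) (Rn-over-S B))
  where
  Rn-over-S : ∀ i {q} → Prime q → q ∣ repunit b (n i) → q ∈ S
  Rn-over-S i {q} pq q∣R = S-covers i q pq (subst (q ∣_) (sym (u-ones b 2≤b (n i))) q∣R)
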